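{- Suppose $P$ is a $2$-chain with $|P|\geq 3$. Then $P$ has no automorphisms except the identity.
   Context: All posets are finite; partial orders are written $\preceq$. A poset $(P,\preceq)$ is a $2$-chain if (1) there is a unique way to write $P$ as the (set) union of two chains, and (2) $\preceq$ is maximal subject to (1), i.e. for every proper refinement $\preceq^+$ of $\preceq$ there is more than one way to write $P$ as the union of two $\preceq^+$-chains. -}

module Defs where

open import Data.Nat using (ℕ)
open import Data.Fin using (Fin)
open import Data.Fin.Subset using (Subset; _∈_; _∪_; ⊤)
open import Data.Product using (Σ; ∃; ∃-syntax; _×_; _,_)
open import Data.Sum using (_⊎_)
open import Level using (0ℓ)
open import Relation.Nullary using (¬_)
open import Relation.Binary using (Rel; IsDecPartialOrder)
open import Relation.Binary.PropositionalEquality using (_≡_)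
open import Data.Fin.Permutation using (Permutation′; _⟨$⟩ʳ_)
open import Function.Bundles using (_⇔_)

record FinPoset (n : ℕ) : Set₁ where
  field
    _≼_ : Rel (Fin n) 0ℓ
    isDecPartialOrder : IsDecPartialOrder _≡_ _≼_

open FinPoset public

module _ {n : ℕ} (P : FinPoset n) where

  IsChain : Subset n → Set
  IsChain A = ∀ x y → x ∈ A → y ∈ A → (_≼_ P x y) ⊎ (_≼_ P y x)

  -- A way to write P as the union of two chains (as an ordered pair;
  -- equality of ways is taken up to swapping, see ≈Cover).
  record Cover : Set where
    constructor cover
    field
      A B : Subset n
      A-chain : IsChain A
      B-chain : IsChain B
      union : A ∪ B ≡ ⊤

  open Cover public

  _≈Cover_ : Cover → Cover → Set
  c ≈Cover d = (A c ≡ A d × B c ≡ B d) ⊎ (A c ≡ B d × B c ≡ A d)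

  UniqueCover : Set
  UniqueCover = Σ Cover λ c → ∀ d → d ≈Cover c

  SeveralCovers : Set
  SeveralCovers = Σ Cover λ c → Σ Cover λ d → ¬ (c ≈Cover d)

ProperRefinement : {n : ℕ} → FinPoset n → FinPoset n → Set
ProperRefinement P Q =
  (∀ x y → _≼_ P x y → _≼_ Q x y) × (∃[ x ] ∃[ y ] (_≼_ Q x y × ¬ (_≼_ P x y)))

Is2Chain : {n : ℕ} → FinPoset n → Set₁
Is2Chain {n} P =
  UniqueCover P × (∀ (Q : FinPoset n) → ProperRefinement P Q → SeveralCovers Q)

IsAutomorphism : {n : ℕ} → FinPoset n → Permutation′ n → Set
IsAutomorphism P σ = ∀ x y → (_≼_ P x y ⇔ _≼_ P (σ ⟨$⟩ʳ x) (σ ⟨$⟩ʳ y))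

-- The automorphism σ carries the unique chain cover {A, B} to a chain cover, so it either
-- fixes A and B or swaps them.  If it fixes them, every x is comparable with σ x, and an
-- injective monotone self-map of a finite poset fixes every point comparable with its image.
-- If it swaps them, σ is an involution and each x is incomparable with σ x.  Take x₀ ∈ A
-- minimal, y₀ = σ x₀ ∈ B, and v maximal among the elements incomparable with x₀, so that
-- everything strictly above v lies above x₀.  If v = y₀, trading x₀ and y₀ between the chains
-- gives a second cover, distinct from {A, B} because some third point stays put.  Otherwise
-- adjoining x₀ < v is a proper refinement whose chain covers are still covers of P: y₀ stays
-- incomparable with x₀ and with σ v, and σ v with v, so no chain of such a cover holds both x₀
-- and v.  This contradicts maximality.

module Submission where

open import Defs
open import Data.Nat using (ℕ; zero; suc; _+_; _≤_; s≤s; _≤′_; ≤′-refl; ≤′-step)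
open import Data.Nat.Properties using (n<1+n; ≤⇒≤′)
open import Data.Fin using (Fin; zero; toℕ; punchIn; punchOut)
open import Data.Fin.Properties
  using (_≟_; any?; pigeonhole; punchInᵢ≢i; punchIn-injective; punchIn-punchOut)
open import Data.Fin.Induction using (po-noetherian)
open import Data.Fin.Subset using (Subset; _∈_; _⊆_)
open import Data.Fin.Subset.Properties using (x∈p∪q⁺; x∈p∪q⁻; ∈⊤; ⊆⊤; ⊆-antisym; _∈?_)
open import Data.Fin.Permutation using (Permutation′; _⟨$⟩ʳ_; _⟨$⟩ˡ_; inverseˡ; inverseʳ)
open import Data.Vec using (tabulate)
open import Data.Vec.Properties using (lookup∘tabulate; lookup⇒[]=; []=⇒lookup)
open import Data.Product using (∃-syntax; _×_; _,_; proj₁; proj₂)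
open import Data.Sum using (_⊎_; inj₁; inj₂; [_,_]′) renaming (map to ⊎-map; swap to ⊎-swap)
open import Data.Unit using (tt)
open import Data.Empty using (⊥; ⊥-elim)
open import Function using (_∘_; flip; Equivalence)
open import Function.Definitions using (Injective)
open import Induction.WellFounded using (Acc; acc)
open import Level using (0ℓ)
open import Relation.Binary using (Rel; IsPartialOrder; IsDecPartialOrder; Decidable; _Preserves_⟶_)
import Relation.Binary.Construct.Flip.EqAndOrd as Flip
open import Relation.Binary.PropositionalEquality
  using (_≡_; _≢_; refl; sym; trans; subst; subst₂; cong)
open import Relation.Nullary using (¬_; yes; no; ¬?; does; contradiction)
open import Relation.Nullary.Decidable
  using (_×-dec_; _⊎-dec_; dec-true; dec-false; decidable-stable)
open import Relation.Unary using (Pred) renaming (Decidable to Decidable₁)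

module _ {n p} {S : Pred (Fin n) p} (S? : Decidable₁ S) where

  subsetOf : Subset n
  subsetOf = tabulate (does ∘ S?)

  ∈-subsetOf⁺ : ∀ {x} → S x → x ∈ subsetOf
  ∈-subsetOf⁺ {x} Sx = lookup⇒[]= x subsetOf (trans (lookup∘tabulate _ x) (dec-true (S? x) Sx))

  ∈-subsetOf⁻ : ∀ {x} → x ∈ subsetOf → S x
  ∈-subsetOf⁻ {x} x∈ = decidable-stable (S? x) λ ¬Sx → contradiction
    (trans (sym ([]=⇒lookup x∈)) (trans (lookup∘tabulate _ x) (dec-false (S? x) ¬Sx))) λ ()

third-element : ∀ {k} (a b : Fin (3 + k)) → a ≢ b → ∃[ z ] z ≢ a × z ≢ b
third-element a b a≢b = punchIn a (punchIn b′ zero) , punchInᵢ≢i a _ , λ z≡b →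
  punchInᵢ≢i b′ zero (punchIn-injective a _ _ (trans z≡b (sym (punchIn-punchOut a≢b))))
  where b′ = punchOut a≢b

module _ {n ℓ} {_⊑_ : Rel (Fin n) ℓ} (po : IsPartialOrder _≡_ _⊑_) where
  open IsPartialOrder po using () renaming (refl to ⊑-refl; trans to ⊑-trans; antisym to ⊑-antisym)

  -- The orbit x ⊑ f x ⊑ f² x ⊑ ⋯ must repeat, and a repetition collapses it by antisymmetry.
  inflated⇒fixed : (f : Fin n → Fin n) → f Preserves _⊑_ ⟶ _⊑_ → Injective _≡_ _≡_ f →
                   ∀ {x} → x ⊑ f x → f x ≡ x
  inflated⇒fixed f mono inj {x} x⊑fx =
    let i , j , i<j , orbitᵢ≡orbitⱼ = pigeonhole (n<1+n n) (λ i → orbit (toℕ i)) in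
    collapse (toℕ i)
      (⊑-antisym (subst (orbit (suc (toℕ i)) ⊑_) (sym orbitᵢ≡orbitⱼ) (ascending (≤⇒≤′ i<j)))
                 (ascends (toℕ i)))
    where
    orbit : ℕ → Fin n
    orbit zero = x
    orbit (suc k) = f (orbit k)

    ascends : ∀ k → orbit k ⊑ orbit (suc k)
    ascends zero = x⊑fx
    ascends (suc k) = mono (ascends k)

    ascending : ∀ {i j} → i ≤′ j → orbit i ⊑ orbit j
    ascending ≤′-refl = ⊑-refl
    ascending {j = suc j} (≤′-step i≤′j) = ⊑-trans (ascending i≤′j) (ascends j)

    collapse : ∀ k → orbit (suc k) ≡ orbit k → f x ≡ x
    collapse zero eq = eq
    collapse (suc k) eq = collapse k (inj eq)

  module _ (_⊑?_ : Decidable _⊑_) where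

    maximal : ∀ {p} {S : Pred (Fin n) p} → Decidable₁ S → ∀ {s} → S s →
              ∃[ m ] S m × (∀ {w} → S w → m ⊑ w → w ≡ m)
    maximal {S = S} S? = go (po-noetherian po _)
      where
      _⊏_ : Rel (Fin n) ℓ
      x ⊏ y = x ⊑ y × x ≢ y

      go : ∀ {s} → Acc (flip _⊏_) s → S s → ∃[ m ] S m × (∀ {w} → S w → m ⊑ w → w ≡ m)
      go {s} (acc above) Ss with any? (λ w → S? w ×-dec (s ⊑? w) ×-dec ¬? (s ≟ w))
      ... | yes (w , Sw , s⊏w) = go (above s⊏w) Sw
      ... | no none = s , Ss , λ {w} Sw s⊑w →
        decidable-stable (w ≟ s) λ w≢s → none (w , Sw , s⊑w , w≢s ∘ sym)

comparable⇒fixed : ∀ {n ℓ} {_⊑_ : Rel (Fin n) ℓ} → IsPartialOrder _≡_ _⊑_ →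
                   (f : Fin n → Fin n) → f Preserves _⊑_ ⟶ _⊑_ → Injective _≡_ _≡_ f →
                   ∀ {x} → x ⊑ f x ⊎ f x ⊑ x → f x ≡ x
comparable⇒fixed po f mono inj (inj₁ x⊑fx) = inflated⇒fixed po f mono inj x⊑fx
comparable⇒fixed po f mono inj (inj₂ fx⊑x) = inflated⇒fixed (Flip.isPartialOrder po) f mono inj fx⊑x

minimal : ∀ {n ℓ} {_⊑_ : Rel (Fin n) ℓ} → IsDecPartialOrder _≡_ _⊑_ → Fin n →
          ∃[ m ] ∀ {w} → w ⊑ m → w ≡ m
minimal dpo x =
  let m , _ , m-minimal =
        maximal (Flip.isPartialOrder isPartialOrder) (flip _≤?_) (λ _ → yes tt) {x} tt
  in m , m-minimal tt
  where open IsDecPartialOrder dpo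

module Covers {n} (P : FinPoset n) where
  open IsDecPartialOrder (isDecPartialOrder P) public
    using (isPartialOrder; _≤?_)
    renaming (refl to ⊑-refl; trans to ⊑-trans; antisym to ⊑-antisym)

  _⊑_ : Rel (Fin n) 0ℓ
  _⊑_ = _≼_ P

  Minimal : Fin n → Set
  Minimal m = ∀ {w} → w ⊑ m → w ≡ m

  incomparable-in-chain : ∀ {X x y} → IsChain P X → x ∈ X → y ∈ X → ¬ x ⊑ y → ¬ y ⊑ x → ⊥
  incomparable-in-chain X-chain x∈X y∈X x⋢y y⋢x = [ x⋢y , y⋢x ]′ (X-chain _ _ x∈X y∈X)

  chain-⊆ : ∀ {X Y} → Y ⊆ X → IsChain P X → IsChain P Y
  chain-⊆ Y⊆X X-chain x y x∈Y y∈Y = X-chain x y (Y⊆X x∈Y) (Y⊆X y∈Y)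

  cover′ : ∀ {X Y} → IsChain P X → IsChain P Y → (∀ x → x ∈ X ⊎ x ∈ Y) → Cover P
  cover′ {X} {Y} X-chain Y-chain covers =
    cover X Y X-chain Y-chain (⊆-antisym ⊆⊤ λ {x} _ → x∈p∪q⁺ (covers x))

  ∈A⊎∈B : (c : Cover P) → ∀ x → x ∈ A c ⊎ x ∈ B c
  ∈A⊎∈B c x = x∈p∪q⁻ (A c) (B c) (subst (x ∈_) (sym (union c)) ∈⊤)

  ≈Cover-sym : ∀ {c d} → _≈Cover_ P c d → _≈Cover_ P d c
  ≈Cover-sym (inj₁ (eqA , eqB)) = inj₁ (sym eqA , sym eqB)
  ≈Cover-sym (inj₂ (eqA , eqB)) = inj₂ (sym eqB , sym eqA)

  ≈Cover-trans : ∀ {c d e} → _≈Cover_ P c d → _≈Cover_ P d e → _≈Cover_ P c e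
  ≈Cover-trans (inj₁ (p , q)) (inj₁ (r , s)) = inj₁ (trans p r , trans q s)
  ≈Cover-trans (inj₁ (p , q)) (inj₂ (r , s)) = inj₂ (trans p r , trans q s)
  ≈Cover-trans (inj₂ (p , q)) (inj₁ (r , s)) = inj₂ (trans p s , trans q r)
  ≈Cover-trans (inj₂ (p , q)) (inj₂ (r , s)) = inj₁ (trans p s , trans q r)

  Exchanged : Subset n → Fin n → Fin n → Pred (Fin n) 0ℓ
  Exchanged X a b y = (y ≢ a × y ∈ X) ⊎ y ≡ b

  exchanged? : ∀ X a b → Decidable₁ (Exchanged X a b)
  exchanged? X a b y = (¬? (y ≟ a) ×-dec (y ∈? X)) ⊎-dec (y ≟ b)

  exchange : Subset n → Fin n → Fin n → Subset n
  exchange X a b = subsetOf (exchanged? X a b)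

  exchange-chain : ∀ {X a b} → IsChain P X → (∀ {w} → w ∈ X → w ≢ a → b ⊑ w ⊎ w ⊑ b) →
                   IsChain P (exchange X a b)
  exchange-chain {X} {a} {b} X-chain b-comparable x y x∈ y∈ =
    go (∈-subsetOf⁻ (exchanged? X a b) x∈) (∈-subsetOf⁻ (exchanged? X a b) y∈)
    where
    go : ∀ {x y} → Exchanged X a b x → Exchanged X a b y → x ⊑ y ⊎ y ⊑ x
    go (inj₁ (_ , x∈X)) (inj₁ (_ , y∈X)) = X-chain _ _ x∈X y∈X
    go (inj₁ (x≢a , x∈X)) (inj₂ refl) = ⊎-swap (b-comparable x∈X x≢a)
    go (inj₂ refl) (inj₁ (y≢a , y∈X)) = b-comparable y∈X y≢a
    go (inj₂ refl) (inj₂ refl) = inj₁ ⊑-refl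

module Adjoin {n} (P : FinPoset n) (a b : Fin n) where
  open Covers P

  _⊑⁺_ : Rel (Fin n) 0ℓ
  x ⊑⁺ y = x ⊑ y ⊎ (x ⊑ a × b ⊑ y)

  module _ (b⋢a : ¬ b ⊑ a) where

    ⊑⁺-trans : ∀ {x y z} → x ⊑⁺ y → y ⊑⁺ z → x ⊑⁺ z
    ⊑⁺-trans (inj₁ x⊑y) (inj₁ y⊑z) = inj₁ (⊑-trans x⊑y y⊑z)
    ⊑⁺-trans (inj₁ x⊑y) (inj₂ (y⊑a , b⊑z)) = inj₂ (⊑-trans x⊑y y⊑a , b⊑z)
    ⊑⁺-trans (inj₂ (x⊑a , b⊑y)) (inj₁ y⊑z) = inj₂ (x⊑a , ⊑-trans b⊑y y⊑z)
    ⊑⁺-trans (inj₂ (_ , b⊑y)) (inj₂ (y⊑a , _)) = ⊥-elim (b⋢a (⊑-trans b⊑y y⊑a))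

    ⊑⁺-antisym : ∀ {x y} → x ⊑⁺ y → y ⊑⁺ x → x ≡ y
    ⊑⁺-antisym (inj₁ x⊑y) (inj₁ y⊑x) = ⊑-antisym x⊑y y⊑x
    ⊑⁺-antisym (inj₁ x⊑y) (inj₂ (y⊑a , b⊑x)) = ⊥-elim (b⋢a (⊑-trans b⊑x (⊑-trans x⊑y y⊑a)))
    ⊑⁺-antisym (inj₂ (x⊑a , b⊑y)) (inj₁ y⊑x) = ⊥-elim (b⋢a (⊑-trans b⊑y (⊑-trans y⊑x x⊑a)))
    ⊑⁺-antisym (inj₂ (_ , b⊑y)) (inj₂ (y⊑a , _)) = ⊥-elim (b⋢a (⊑-trans b⊑y y⊑a))

    adjoin : FinPoset n
    adjoin = record
      { _≼_ = _⊑⁺_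
      ; isDecPartialOrder = record
        { isPartialOrder = record
          { isPreorder = record
            { isEquivalence = IsPartialOrder.isEquivalence isPartialOrder
            ; reflexive = λ { refl → inj₁ ⊑-refl }
            ; trans = ⊑⁺-trans
            }
          ; antisym = ⊑⁺-antisym
          }
        ; _≟_ = _≟_
        ; _≤?_ = λ x y → (x ≤? y) ⊎-dec ((x ≤? a) ×-dec (b ≤? y))
        }
      }

    adjoin-refines : ¬ a ⊑ b → ProperRefinement P adjoin
    adjoin-refines a⋢b = (λ _ _ → inj₁) , a , b , inj₂ (⊑-refl , ⊑-refl) , a⋢b

module UniqueCoverProperties {n} (P : FinPoset n) (c : Cover P)
                             (unique : ∀ d → _≈Cover_ P d c) where
  open Covers P

  covers-equivalent : ∀ d d′ → _≈Cover_ P d d′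
  covers-equivalent d d′ = ≈Cover-trans {d} {c} {d′} (unique d) (≈Cover-sym {d′} {c} (unique d′))

  disjoint : ∀ {x} → x ∈ A c → x ∈ B c → ⊥
  disjoint {x} x∈A x∈B = proj₁ (∈-subsetOf⁻ without-x? (x∈B-x (unique c-x))) refl
    where
    without-x? : Decidable₁ λ y → y ≢ x × y ∈ B c
    without-x? y = ¬? (y ≟ x) ×-dec (y ∈? B c)

    covers : ∀ y → y ∈ A c ⊎ y ∈ subsetOf without-x?
    covers y with ∈A⊎∈B c y | y ≟ x
    ... | inj₁ y∈A | _ = inj₁ y∈A
    ... | inj₂ _ | yes refl = inj₁ x∈A
    ... | inj₂ y∈B | no y≢x = inj₂ (∈-subsetOf⁺ without-x? (y≢x , y∈B))

    c-x : Cover P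
    c-x = cover′ (A-chain c) (chain-⊆ (proj₂ ∘ ∈-subsetOf⁻ without-x?) (B-chain c)) covers

    x∈B-x : _≈Cover_ P c-x c → x ∈ subsetOf without-x?
    x∈B-x (inj₁ (_ , B-x≡B)) = subst (x ∈_) (sym B-x≡B) x∈B
    x∈B-x (inj₂ (_ , B-x≡A)) = subst (x ∈_) (sym B-x≡A) x∈A

  module _ {a b} (a∈A : a ∈ A c) (b∈B : b ∈ B c)
           (b-comparable : ∀ {w} → w ∈ A c → w ≢ a → b ⊑ w ⊎ w ⊑ b)
           (a-comparable : ∀ {w} → w ∈ B c → w ≢ b → a ⊑ w ⊎ w ⊑ a) where

    exchange-cover : Cover P
    exchange-cover =
      cover′ (exchange-chain (A-chain c) b-comparable) (exchange-chain (B-chain c) a-comparable)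
             covers
      where
      covers : ∀ y → y ∈ exchange (A c) a b ⊎ y ∈ exchange (B c) b a
      covers y with y ≟ a | y ≟ b | ∈A⊎∈B c y
      ... | yes y≡a | _ | _ = inj₂ (∈-subsetOf⁺ (exchanged? (B c) b a) (inj₂ y≡a))
      ... | no _ | yes y≡b | _ = inj₁ (∈-subsetOf⁺ (exchanged? (A c) a b) (inj₂ y≡b))
      ... | no y≢a | no _ | inj₁ y∈A = inj₁ (∈-subsetOf⁺ (exchanged? (A c) a b) (inj₁ (y≢a , y∈A)))
      ... | no _ | no y≢b | inj₂ y∈B = inj₂ (∈-subsetOf⁺ (exchanged? (B c) b a) (inj₁ (y≢b , y∈B)))

    exchange-≉ : ∀ {z} → z ≢ a → z ≢ b → ¬ _≈Cover_ P exchange-cover c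
    exchange-≉ _ _ (inj₁ (A′≡A , _)) =
      disjoint (subst (b ∈_) A′≡A (∈-subsetOf⁺ (exchanged? (A c) a b) (inj₂ refl))) b∈B
    exchange-≉ {z} z≢a z≢b (inj₂ (A′≡B , _)) with ∈A⊎∈B c z
    ... | inj₁ z∈A =
      disjoint z∈A (subst (z ∈_) A′≡B (∈-subsetOf⁺ (exchanged? (A c) a b) (inj₁ (z≢a , z∈A))))
    ... | inj₂ z∈B with ∈-subsetOf⁻ (exchanged? (A c) a b) (subst (z ∈_) (sym A′≡B) z∈B)
    ...   | inj₁ (_ , z∈A) = disjoint z∈A z∈B
    ...   | inj₂ z≡b = z≢b z≡b

    exchange-impossible : ∀ {z} → z ≢ a → z ≢ b → ⊥
    exchange-impossible z≢a z≢b = exchange-≉ z≢a z≢b (unique exchange-cover)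

module Automorphism {n} (P : FinPoset n) (σ : Permutation′ n) (aut : IsAutomorphism P σ) where
  open Covers P

  σʳ σˡ : Fin n → Fin n
  σʳ = σ ⟨$⟩ʳ_
  σˡ = σ ⟨$⟩ˡ_

  σ-mono : σʳ Preserves _⊑_ ⟶ _⊑_
  σ-mono {x} {y} = Equivalence.to (aut x y)

  σ-reflects : ∀ {x y} → σʳ x ⊑ σʳ y → x ⊑ y
  σ-reflects {x} {y} = Equivalence.from (aut x y)

  σ-injective : Injective _≡_ _≡_ σʳ
  σ-injective {x} {y} σx≡σy = trans (sym (inverseˡ σ)) (trans (cong σˡ σx≡σy) (inverseˡ σ))

  σ-minimal : ∀ {m} → Minimal m → Minimal (σʳ m)
  σ-minimal {m} m-minimal {w} w⊑σm =
    trans (sym (inverseʳ σ)) (cong σʳ (m-minimal (σ-reflects σσˡw⊑σm)))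
    where
    σσˡw⊑σm : σʳ (σˡ w) ⊑ σʳ m
    σσˡw⊑σm = subst (_⊑ σʳ m) (sym (inverseʳ σ)) w⊑σm

  σˡ-∈? : ∀ X → Decidable₁ λ y → σˡ y ∈ X
  σˡ-∈? X y = σˡ y ∈? X

  image : Subset n → Subset n
  image X = subsetOf (σˡ-∈? X)

  ∈-image⁺ : ∀ {X x} → x ∈ X → σʳ x ∈ image X
  ∈-image⁺ {X} x∈X = ∈-subsetOf⁺ (σˡ-∈? X) (subst (_∈ X) (sym (inverseˡ σ)) x∈X)

  image-chain : ∀ {X} → IsChain P X → IsChain P (image X)
  image-chain {X} X-chain x y x∈ y∈ = ⊎-map σˡ-reflects σˡ-reflects
    (X-chain _ _ (∈-subsetOf⁻ (σˡ-∈? X) x∈) (∈-subsetOf⁻ (σˡ-∈? X) y∈))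
    where
    σˡ-reflects : ∀ {x y} → σˡ x ⊑ σˡ y → x ⊑ y
    σˡ-reflects σˡx⊑σˡy = subst₂ _⊑_ (inverseʳ σ) (inverseʳ σ) (σ-mono σˡx⊑σˡy)

  image-cover : Cover P → Cover P
  image-cover c = cover′ (image-chain (A-chain c)) (image-chain (B-chain c)) λ y →
    ⊎-map (∈-subsetOf⁺ (σˡ-∈? (A c))) (∈-subsetOf⁺ (σˡ-∈? (B c))) (∈A⊎∈B c (σˡ y))

  fixes-invariant-chain : ∀ {X} → IsChain P X → image X ≡ X → ∀ {x} → x ∈ X → σʳ x ≡ x
  fixes-invariant-chain {X} X-chain invariant {x} x∈X =
    comparable⇒fixed isPartialOrder σʳ σ-mono σ-injective
    (X-chain x (σʳ x) x∈X (subst (σʳ x ∈_) invariant (∈-image⁺ x∈X)))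

  preserving⇒identity : (c : Cover P) → image (A c) ≡ A c → image (B c) ≡ B c → ∀ x → σʳ x ≡ x
  preserving⇒identity c A-invariant B-invariant x =
    [ fixes-invariant-chain (A-chain c) A-invariant
    , fixes-invariant-chain (B-chain c) B-invariant ]′ (∈A⊎∈B c x)

module Swapping {k} (P : FinPoset (3 + k)) (two-chain : Is2Chain P)
                (σ : Permutation′ (3 + k)) (aut : IsAutomorphism P σ) where
  open Covers P
  open Automorphism P σ aut

  c : Cover P
  c = proj₁ (proj₁ two-chain)

  unique : ∀ d → _≈Cover_ P d c
  unique = proj₂ (proj₁ two-chain)

  open UniqueCoverProperties P c unique

  module _ (A↦B : image (A c) ≡ B c) (B↦A : image (B c) ≡ A c) where

    σ-A⊆B : ∀ {x} → x ∈ A c → σʳ x ∈ B c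
    σ-A⊆B x∈A = subst (_ ∈_) A↦B (∈-image⁺ x∈A)

    σ-B⊆A : ∀ {x} → x ∈ B c → σʳ x ∈ A c
    σ-B⊆A x∈B = subst (_ ∈_) B↦A (∈-image⁺ x∈B)

    σ-involutive : ∀ x → σʳ (σʳ x) ≡ x
    σ-involutive x =
      comparable⇒fixed isPartialOrder (σʳ ∘ σʳ) (σ-mono ∘ σ-mono) (σ-injective ∘ σ-injective)
      ([ (λ x∈A → A-chain c _ _ x∈A (σ-B⊆A (σ-A⊆B x∈A)))
       , (λ x∈B → B-chain c _ _ x∈B (σ-A⊆B (σ-B⊆A x∈B))) ]′ (∈A⊎∈B c x))

    σ-moves : ∀ x → σʳ x ≢ x
    σ-moves x σx≡x with ∈A⊎∈B c x
    ... | inj₁ x∈A = disjoint x∈A (subst (_∈ B c) σx≡x (σ-A⊆B x∈A))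
    ... | inj₂ x∈B = disjoint (subst (_∈ A c) σx≡x (σ-B⊆A x∈B)) x∈B

    ⋢σ : ∀ x → ¬ x ⊑ σʳ x
    ⋢σ x x⊑σx = σ-moves x (⊑-antisym (subst (σʳ x ⊑_) (σ-involutive x) (σ-mono x⊑σx)) x⊑σx)

    σ⋢ : ∀ x → ¬ σʳ x ⊑ x
    σ⋢ x σx⊑x = ⋢σ (σʳ x) (subst (σʳ x ⊑_) (sym (σ-involutive x)) σx⊑x)

    minimal-in-A : ∃[ x ] x ∈ A c × Minimal x
    minimal-in-A with minimal (isDecPartialOrder P) zero
    ... | m , m-minimal with ∈A⊎∈B c m
    ...   | inj₁ m∈A = m , m∈A , m-minimal
    ...   | inj₂ m∈B = σʳ m , σ-B⊆A m∈B , σ-minimal m-minimal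

    module _ {x₀} (x₀∈A : x₀ ∈ A c) (x₀-minimal : Minimal x₀) where

      y₀ : Fin (3 + k)
      y₀ = σʳ x₀

      Apart : Pred (Fin (3 + k)) 0ℓ
      Apart w = ¬ x₀ ⊑ w × ¬ w ⊑ x₀

      apart? : Decidable₁ Apart
      apart? w = ¬? (x₀ ≤? w) ×-dec ¬? (w ≤? x₀)

      module _ {v} (v-apart : Apart v) (v-maximal : ∀ {w} → Apart w → v ⊑ w → w ≡ v) where

        above-v : ∀ {w} → v ⊑ w → w ≢ v → x₀ ⊑ w
        above-v {w} v⊑w w≢v with x₀ ≤? w | w ≤? x₀
        ... | yes x₀⊑w | _ = x₀⊑w
        ... | no _ | yes w⊑x₀ = ⊥-elim (proj₂ v-apart (⊑-trans v⊑w w⊑x₀))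
        ... | no x₀⋢w | no w⋢x₀ = ⊥-elim (w≢v (v-maximal (x₀⋢w , w⋢x₀) v⊑w))

        v≢y₀ : v ≢ y₀
        v≢y₀ v≡y₀ with third-element x₀ y₀ (σ-moves x₀ ∘ sym)
        ... | z , z≢x₀ , z≢y₀ = exchange-impossible x₀∈A (σ-A⊆B x₀∈A)
          (λ w∈A w≢x₀ → inj₁ (y₀-below-A w∈A w≢x₀)) (λ w∈B w≢y₀ → inj₁ (x₀-below-B w∈B w≢y₀))
          z≢x₀ z≢y₀
          where
          x₀-below-B : ∀ {w} → w ∈ B c → w ≢ y₀ → x₀ ⊑ w
          x₀-below-B {w} w∈B w≢y₀ with B-chain c w y₀ w∈B (σ-A⊆B x₀∈A)
          ... | inj₁ w⊑y₀ = ⊥-elim (w≢y₀ (σ-minimal x₀-minimal w⊑y₀))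
          ... | inj₂ y₀⊑w = above-v (subst (_⊑ w) (sym v≡y₀) y₀⊑w) (w≢y₀ ∘ flip trans v≡y₀)

          y₀-below-A : ∀ {w} → w ∈ A c → w ≢ x₀ → y₀ ⊑ w
          y₀-below-A {w} w∈A w≢x₀ =
            subst (y₀ ⊑_) (σ-involutive w) (σ-mono (x₀-below-B (σ-A⊆B w∈A) (w≢x₀ ∘ σ-injective)))

        module _ (v≢y₀ : v ≢ y₀) where
          open Adjoin P x₀ v using (_⊑⁺_; adjoin; adjoin-refines)

          P⁺ : FinPoset (3 + k)
          P⁺ = adjoin (proj₂ v-apart)

          open Covers P⁺
            using () renaming (incomparable-in-chain to incomparable-in-chain⁺; ∈A⊎∈B to ∈A⊎∈B⁺)

          v⋢y₀ : ¬ v ⊑ y₀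
          v⋢y₀ v⊑y₀ = ⋢σ x₀ (above-v v⊑y₀ (v≢y₀ ∘ sym))

          σv⋢x₀ : ¬ σʳ v ⊑ x₀
          σv⋢x₀ σv⊑x₀ = v⋢y₀ (σ-reflects (subst (σʳ v ⊑_) (sym (σ-involutive x₀)) σv⊑x₀))

          ⋢⁺ : ∀ {x y} → ¬ x ⊑ y → ¬ x ⊑ x₀ ⊎ ¬ v ⊑ y → ¬ x ⊑⁺ y
          ⋢⁺ x⋢y _ (inj₁ x⊑y) = x⋢y x⊑y
          ⋢⁺ _ (inj₁ x⋢x₀) (inj₂ (x⊑x₀ , _)) = x⋢x₀ x⊑x₀
          ⋢⁺ _ (inj₂ v⋢y) (inj₂ (_ , v⊑y)) = v⋢y v⊑y

          x₀,v-separated : ∀ {X Y} → IsChain P⁺ X → IsChain P⁺ Y →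
                           (∀ z → z ∈ X ⊎ z ∈ Y) → ¬ (x₀ ∈ X × v ∈ X)
          x₀,v-separated X-chain Y-chain covers (x₀∈X , v∈X) with covers y₀ | covers (σʳ v)
          ... | inj₁ y₀∈X | _ = incomparable-in-chain⁺ X-chain x₀∈X y₀∈X
            (⋢⁺ (⋢σ x₀) (inj₂ v⋢y₀)) (⋢⁺ (σ⋢ x₀) (inj₁ (σ⋢ x₀)))
          ... | inj₂ _ | inj₁ σv∈X = incomparable-in-chain⁺ X-chain σv∈X v∈X
            (⋢⁺ (σ⋢ v) (inj₁ σv⋢x₀)) (⋢⁺ (⋢σ v) (inj₁ (proj₂ v-apart)))
          ... | inj₂ y₀∈Y | inj₂ σv∈Y = incomparable-in-chain⁺ Y-chain y₀∈Y σv∈Y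
            (⋢⁺ (proj₁ v-apart ∘ σ-reflects) (inj₁ (σ⋢ x₀)))
            (⋢⁺ (proj₂ v-apart ∘ σ-reflects) (inj₁ σv⋢x₀))

          chain⁺⇒chain : ∀ {X} → IsChain P⁺ X → ¬ (x₀ ∈ X × v ∈ X) → IsChain P X
          chain⁺⇒chain {X} X-chain not-both x y x∈X y∈X =
            [ weaken x∈X y∈X , ⊎-swap ∘ weaken y∈X x∈X ]′ (X-chain x y x∈X y∈X)
            where
            weaken : ∀ {x y} → x ∈ X → y ∈ X → x ⊑⁺ y → x ⊑ y ⊎ y ⊑ x
            weaken _ _ (inj₁ x⊑y) = inj₁ x⊑y
            weaken {x} {y} x∈X y∈X (inj₂ (x⊑x₀ , v⊑y)) with x₀-minimal x⊑x₀ | y ≟ v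
            ... | refl | yes refl = ⊥-elim (not-both (x∈X , y∈X))
            ... | refl | no y≢v = inj₁ (above-v v⊑y y≢v)

          restrict : Cover P⁺ → Cover P
          restrict d = cover (A d) (B d)
            (chain⁺⇒chain (A-chain d) (x₀,v-separated (A-chain d) (B-chain d) (∈A⊎∈B⁺ d)))
            (chain⁺⇒chain (B-chain d) (x₀,v-separated (B-chain d) (A-chain d) (⊎-swap ∘ ∈A⊎∈B⁺ d)))
            (union d)

          maximality-violated : ⊥
          maximality-violated
            with proj₂ two-chain P⁺ (adjoin-refines (proj₂ v-apart) (proj₁ v-apart))
          ... | d , d′ , d≉d′ = d≉d′ (covers-equivalent (restrict d) (restrict d′))

        v≡y₀ : v ≡ y₀
        v≡y₀ = decidable-stable (v ≟ y₀) maximality-violated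

      no-minimal-in-A : ⊥
      no-minimal-in-A =
        let v , v-apart , v-maximal = maximal isPartialOrder _≤?_ apart? (⋢σ x₀ , σ⋢ x₀) in
        v≢y₀ v-apart v-maximal (v≡y₀ v-apart v-maximal)

    swapping-impossible : ⊥
    swapping-impossible =
      let _ , x₀∈A , x₀-minimal = minimal-in-A in no-minimal-in-A x₀∈A x₀-minimal

proposition3p3 : (n : ℕ) → 3 ≤ n → (P : FinPoset n) → Is2Chain P →
    (σ : Permutation′ n) → IsAutomorphism P σ → ∀ x → σ ⟨$⟩ʳ x ≡ x
proposition3p3 (suc (suc (suc k))) (s≤s (s≤s (s≤s _))) P two-chain σ aut =
  by-cases (unique (image-cover c))
  where
  open Automorphism P σ aut
  open Swapping P two-chain σ aut

  by-cases : _≈Cover_ P (image-cover c) c → ∀ x → σʳ x ≡ x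
  by-cases (inj₁ (A↦A , B↦B)) = preserving⇒identity c A↦A B↦B
  by-cases (inj₂ (A↦B , B↦A)) = ⊥-elim (swapping-impossible A↦B B↦A)
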